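{- There is a constant $c$ such that for every algebraic circuit $G(\bar x)$ over $\mathbb{Q}$ there are algebraic circuits $G_P(\bar x)$ and $G_N(\bar x)$ over $\mathbb{Q}$, each of size at most $c|G|$ and each $\emptyset$-conic, such that the circuit $G_P-G_N$ computes the same polynomial as $G$.
   Context: Algebraic circuits over $\mathbb{Q}$ have leaves labelled by variables or rational constants and fan-in-two $+,\times$ gates; size $|G|$ is the number of nodes (each constant counts as one node). A squaring gate is a product gate both of whose inputs come from the same node. A circuit is $\emptyset$-conic if for every leaf labelled by a negative constant or by a variable, every directed path from that leaf to the output gate passes through a squaring gate (so it computes a polynomial nonnegative on all real inputs). -}

module Defs where

open import Data.Nat as ℕ using (ℕ; zero; suc; _≤_; s≤s⁻¹)
open import Data.Nat.Properties using (≤-refl; <⇒≤)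
open import Data.Fin as Fin using (Fin; toℕ; fromℕ; fromℕ<; inject)
open import Data.Fin.Properties using (toℕ-fromℕ<)
open import Data.Rational using (ℚ; _+_; _*_; _<_; 0ℚ)
open import Data.Vec using (Vec; []; _∷ʳ_; lookup; last)
open import Data.Product using (Σ; ∃; _×_; _,_)
open import Data.Sum using (_⊎_)
open import Relation.Binary.PropositionalEquality using (_≡_; subst)

-- A gate of a circuit in the variables x₀ … x_{n-1}, sitting at a node
-- which has k earlier nodes (numbered 0 … k-1) available as inputs.
data Gate (n k : ℕ) : Set where
  var   : Fin n → Gate n k
  const : ℚ → Gate n k
  add   : Fin k → Fin k → Gate n k
  mul   : Fin k → Fin k → Gate n k

-- An algebraic circuit over ℚ with n variables and s nodes:
-- a DAG whose nodes are 0 … s-1 in topological order; node k may only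
-- take inputs from nodes with smaller index.  The size |G| is s.
Circuit : ℕ → ℕ → Set
Circuit n s = (k : Fin s) → Gate n (toℕ k)

output : ∀ {m} → Fin (suc m)
output {m} = fromℕ m

evalGate : ∀ {n k} → (Fin n → ℚ) → Gate n k → Vec ℚ k → ℚ
evalGate x (var v)   vs = x v
evalGate x (const q) vs = q
evalGate x (add i j) vs = lookup vs i + lookup vs j
evalGate x (mul i j) vs = lookup vs i * lookup vs j

values : ∀ {n s} → Circuit n s → (Fin n → ℚ) → (m : ℕ) → m ≤ s → Vec ℚ m
values C x zero    _ = []
values C x (suc m) p =
  vs ∷ʳ evalGate x (subst (λ k → Gate _ k) (toℕ-fromℕ< p) (C (fromℕ< p))) vs
  where vs = values C x m (<⇒≤ p)

eval : ∀ {n m} → Circuit n (suc m) → (Fin n → ℚ) → ℚ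
eval {m = m} C x = last (values C x (suc m) ≤-refl)

data Wire {n s} (C : Circuit n s) : Fin s → Fin s → Set where
  add-l : ∀ {b i j} → C b ≡ add i j → Wire C (inject i) b
  add-r : ∀ {b i j} → C b ≡ add i j → Wire C (inject j) b
  mul-l : ∀ {b i j} → C b ≡ mul i j → Wire C (inject i) b
  mul-r : ∀ {b i j} → C b ≡ mul i j → Wire C (inject j) b

data Path {n s} (C : Circuit n s) : Fin s → Fin s → Set where
  here : ∀ {a} → Path C a a
  step : ∀ {a b c} → Wire C a b → Path C b c → Path C a c

IsSquaring : ∀ {n s} → Circuit n s → Fin s → Set
IsSquaring C k = ∃ λ i → C k ≡ mul i i

PassesSquaring : ∀ {n s} {C : Circuit n s} {a c} → Path C a c → Set
PassesSquaring {C = C} {a = a} here       = IsSquaring C a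
PassesSquaring {C = C} {a = a} (step _ π) = IsSquaring C a ⊎ PassesSquaring π

BadLeaf : ∀ {n s} → Circuit n s → Fin s → Set
BadLeaf C k = (∃ λ v → C k ≡ var v) ⊎ (∃ λ q → q < 0ℚ × C k ≡ const q)

Conic : ∀ {n m} → Circuit n (suc m) → Set
Conic C = ∀ ℓ → BadLeaf C ℓ → (π : Path C ℓ output) → PassesSquaring π

{-# OPTIONS --safe #-}
-- Every rational f equals (f + ¼)² − (f − ¼)².  So G_P and G_N append to G a
-- constant ±¼, an addition and a squaring gate: three new nodes each.  Their output
-- is a squaring gate, so every path to it trivially passes through one.
module Submission where

open import Defs
open import Data.Nat using (ℕ; suc; _≤_; _*_)
open import Data.Fin using (Fin)
open import Data.Rational using (ℚ; _-_)
open import Data.Product using (Σ; ∃; ∃-syntax; _×_)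
open import Relation.Binary.PropositionalEquality using (_≡_)

open import Data.Nat using (zero; _<_; _≟_; s≤s; s≤s⁻¹)
open import Data.Nat.Properties using (≤-refl; <⇒≤; <-irrefl; ≤∧≢⇒<; m≤n⇒m≤1+n; *-comm; m≤m*n)
open import Data.Fin as Fin using (toℕ; fromℕ; fromℕ<; inject₁)
open import Data.Fin.Properties using (toℕ-fromℕ<; toℕ-fromℕ; toℕ<n)
open import Data.Vec using (Vec; []; _∷_; _∷ʳ_; lookup; last)
open import Data.Vec.Properties using (last-∷ʳ)
open import Data.Product using (_,_)
open import Data.Sum using (inj₂)
open import Data.Empty using (⊥-elim)
open import Data.Integer using (+_)
open import Data.Rational using (_+_; -_; _/_) renaming (_*_ to _*ℚ_)
open import Data.Rational.Properties using (*-identityˡ)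
open import Data.Rational.Solver using (module +-*-Solver)
open import Relation.Nullary using (yes; no)
open import Relation.Binary.PropositionalEquality
  using (refl; sym; trans; cong; cong₂; subst; module ≡-Reasoning)

private
  variable
    n s : ℕ

lookup-∷ʳ-last : ∀ {A : Set} (xs : Vec A s) y → lookup (xs ∷ʳ y) (fromℕ s) ≡ y
lookup-∷ʳ-last []       y = refl
lookup-∷ʳ-last (_ ∷ xs) y = lookup-∷ʳ-last xs y

lookup-∷ʳ-inject₁ : ∀ {A : Set} (xs : Vec A s) y i → lookup (xs ∷ʳ y) (inject₁ i) ≡ lookup xs i
lookup-∷ʳ-inject₁ (_ ∷ xs) y Fin.zero    = refl
lookup-∷ʳ-inject₁ (_ ∷ xs) y (Fin.suc i) = lookup-∷ʳ-inject₁ xs y i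

-- Nodes are indexed by plain numbers with irrelevant bounds, so that appending a
-- node needs no transport between `Fin s` and `Fin (suc s)`.
Gates : ℕ → ℕ → Set
Gates n s = (j : ℕ) → .(j < s) → Gate n j

toCircuit : Gates n s → Circuit n s
toCircuit F k = F (toℕ k) (toℕ<n k)

fromCircuit : Circuit n s → Gates n s
fromCircuit G j j<s = subst (Gate _) (toℕ-fromℕ< j<s) (G (fromℕ< j<s))

valuesᴳ : Gates n s → (Fin n → ℚ) → (m : ℕ) → .(m ≤ s) → Vec ℚ m
valuesᴳ F x zero    _   = []
valuesᴳ F x (suc m) m<s = vs ∷ʳ evalGate x (F m m<s) vs
  where vs = valuesᴳ F x m (<⇒≤ m<s)

value : Gates n s → (Fin n → ℚ) → (j : ℕ) → .(j < s) → ℚ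
value F x j j<s = evalGate x (F j j<s) (valuesᴳ F x j (<⇒≤ j<s))

values-fromCircuit : ∀ (G : Circuit n s) x m (m≤s : m ≤ s) →
                     values G x m m≤s ≡ valuesᴳ (fromCircuit G) x m m≤s
values-fromCircuit G x zero    _   = refl
values-fromCircuit G x (suc m) m<s =
  cong (λ vs → vs ∷ʳ evalGate x (fromCircuit G m m<s) vs)
       (values-fromCircuit G x m (<⇒≤ m<s))

subst-Gates : ∀ (F : Gates n s) {i j} (i≡j : i ≡ j) .(i<s : i < s) .(j<s : j < s) →
              subst (Gate n) i≡j (F i i<s) ≡ F j j<s
subst-Gates F refl _ _ = refl

values-toCircuit : ∀ (F : Gates n s) x m (m≤s : m ≤ s) →
                   values (toCircuit F) x m m≤s ≡ valuesᴳ F x m m≤s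
values-toCircuit F x zero    _   = refl
values-toCircuit F x (suc m) m<s =
  cong₂ (λ vs g → vs ∷ʳ evalGate x g vs)
        (values-toCircuit F x m (<⇒≤ m<s))
        (subst-Gates F (toℕ-fromℕ< m<s) _ m<s)

eval-fromCircuit : ∀ {m} (G : Circuit n (suc m)) x → eval G x ≡ value (fromCircuit G) x m ≤-refl
eval-fromCircuit {m = m} G x =
  trans (cong last (values-fromCircuit G x (suc m) ≤-refl))
        (last-∷ʳ (value (fromCircuit G) x m ≤-refl) (valuesᴳ (fromCircuit G) x m _))

eval-toCircuit : ∀ {m} (F : Gates n (suc m)) x → eval (toCircuit F) x ≡ value F x m ≤-refl
eval-toCircuit {m = m} F x =
  trans (cong last (values-toCircuit F x (suc m) ≤-refl))
        (last-∷ʳ (value F x m ≤-refl) (valuesᴳ F x m _))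

lookup-valuesᴳ-last : ∀ (F : Gates n s) x {j} (j<s : j < s) →
                      lookup (valuesᴳ F x (suc j) j<s) (fromℕ j) ≡ value F x j j<s
lookup-valuesᴳ-last F x {j} j<s = lookup-∷ʳ-last (valuesᴳ F x j (<⇒≤ j<s)) (value F x j j<s)

lookup-valuesᴳ-penultimate : ∀ (F : Gates n s) x {j} (1+j<s : suc j < s) →
  lookup (valuesᴳ F x (suc (suc j)) 1+j<s) (inject₁ (fromℕ j)) ≡ value F x j (<⇒≤ 1+j<s)
lookup-valuesᴳ-penultimate F x {j} 1+j<s =
  trans (lookup-∷ʳ-inject₁ (valuesᴳ F x (suc j) (<⇒≤ 1+j<s)) (value F x (suc j) 1+j<s) (fromℕ j))
        (lookup-valuesᴳ-last F x (<⇒≤ 1+j<s))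

infixl 5 _▷_

_▷_ : Gates n s → Gate n s → Gates n (suc s)
_▷_ {s = s} F g j j<1+s with j ≟ s
... | yes refl = g
... | no  j≢s  = F j (≤∧≢⇒< (s≤s⁻¹ j<1+s) j≢s)

▷-new : ∀ (F : Gates n s) g → (F ▷ g) s ≤-refl ≡ g
▷-new {s = s} F g with s ≟ s
... | yes refl = refl
... | no  s≢s  = ⊥-elim (s≢s refl)

▷-old : ∀ (F : Gates n s) g {j} (j<s : j < s) → (F ▷ g) j (m≤n⇒m≤1+n j<s) ≡ F j j<s
▷-old {s = s} F g {j} j<s with j ≟ s
... | yes refl = ⊥-elim (<-irrefl refl j<s)
... | no  _    = refl

valuesᴳ-▷ : ∀ (F : Gates n s) g x m (m≤s : m ≤ s) →
            valuesᴳ (F ▷ g) x m (m≤n⇒m≤1+n m≤s) ≡ valuesᴳ F x m m≤s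
valuesᴳ-▷ F g x zero    _   = refl
valuesᴳ-▷ F g x (suc m) m<s =
  cong₂ (λ vs g′ → vs ∷ʳ evalGate x g′ vs) (valuesᴳ-▷ F g x m (<⇒≤ m<s)) (▷-old F g m<s)

value-▷-old : ∀ (F : Gates n s) g x {j} (j<s : j < s) →
              value (F ▷ g) x j (m≤n⇒m≤1+n j<s) ≡ value F x j j<s
value-▷-old F g x {j} j<s = cong₂ (evalGate x) (▷-old F g j<s) (valuesᴳ-▷ F g x j (<⇒≤ j<s))

value-▷-new : ∀ (F : Gates n s) g x → value (F ▷ g) x s ≤-refl ≡ evalGate x g (valuesᴳ F x s ≤-refl)
value-▷-new {s = s} F g x = cong₂ (evalGate x) (▷-new F g) (valuesᴳ-▷ F g x s ≤-refl)

passesSquaring-at-end : ∀ {C : Circuit n s} {a c} → IsSquaring C c →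
                        (π : Path C a c) → PassesSquaring π
passesSquaring-at-end sq here       = sq
passesSquaring-at-end sq (step _ π) = inj₂ (passesSquaring-at-end sq π)

squaring-output⇒conic : ∀ {m} {C : Circuit n (suc m)} → IsSquaring C output → Conic C
squaring-output⇒conic sq _ _ = passesSquaring-at-end sq

▷-squaring : ∀ (F : Gates n s) i → IsSquaring (toCircuit (F ▷ mul i i)) (fromℕ s)
▷-squaring {s = s} F i = squaring-at (toℕ-fromℕ s) (toℕ<n (fromℕ s))
  where
  squaring-at : ∀ {j} → j ≡ s → .(j<1+s : j < suc s) → ∃ λ i′ → (F ▷ mul i i) j j<1+s ≡ mul i′ i′
  squaring-at refl _ = i , ▷-new F (mul i i)

module ShiftedSquare {m} (G : Circuit n (suc m)) (a : ℚ) where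

  withConstant : Gates n (suc (suc m))
  withConstant = fromCircuit G ▷ const a

  withSum : Gates n (suc (suc (suc m)))
  withSum = withConstant ▷ add (inject₁ (fromℕ m)) (fromℕ (suc m))

  sq : Gate n (suc (suc (suc m)))
  sq = mul (fromℕ (suc (suc m))) (fromℕ (suc (suc m)))

  circuit : Circuit n (suc (suc (suc (suc m))))
  circuit = toCircuit (withSum ▷ sq)

  conic : Conic circuit
  conic = squaring-output⇒conic (▷-squaring withSum (fromℕ (suc (suc m))))

  value-withSum : ∀ x → value withSum x (suc (suc m)) ≤-refl ≡ eval G x + a
  value-withSum x = begin
    value withSum x (suc (suc m)) ≤-refl
      ≡⟨ value-▷-new withConstant _ x ⟩
    lookup vs (inject₁ (fromℕ m)) + lookup vs (fromℕ (suc m))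
      ≡⟨ cong₂ _+_ (lookup-valuesᴳ-penultimate withConstant x ≤-refl)
                   (lookup-valuesᴳ-last withConstant x ≤-refl) ⟩
    value withConstant x m (m≤n⇒m≤1+n ≤-refl) + value withConstant x (suc m) ≤-refl
      ≡⟨ cong₂ _+_ (value-▷-old (fromCircuit G) _ x ≤-refl) (value-▷-new (fromCircuit G) _ x) ⟩
    value (fromCircuit G) x m ≤-refl + a
      ≡⟨ cong (_+ a) (sym (eval-fromCircuit G x)) ⟩
    eval G x + a ∎
    where
    open ≡-Reasoning
    vs = valuesᴳ withConstant x (suc (suc m)) ≤-refl

  eval-circuit : ∀ x → eval circuit x ≡ (eval G x + a) *ℚ (eval G x + a)
  eval-circuit x = begin
    eval circuit x
      ≡⟨ eval-toCircuit (withSum ▷ sq) x ⟩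
    value (withSum ▷ sq) x (suc (suc (suc m))) ≤-refl
      ≡⟨ value-▷-new withSum sq x ⟩
    lookup vs (fromℕ (suc (suc m))) *ℚ lookup vs (fromℕ (suc (suc m)))
      ≡⟨ cong (λ y → y *ℚ y) (trans (lookup-valuesᴳ-last withSum x ≤-refl) (value-withSum x)) ⟩
    (eval G x + a) *ℚ (eval G x + a) ∎
    where
    open ≡-Reasoning
    vs = valuesᴳ withSum x (suc (suc (suc m))) ≤-refl

difference-of-shifted-squares : ∀ f a → (f + a) *ℚ (f + a) - (f - a) *ℚ (f - a) ≡ ((a + a) + (a + a)) *ℚ f
difference-of-shifted-squares = solve 2 (λ f a →
  (f :+ a) :* (f :+ a) :+ :- ((f :+ :- a) :* (f :+ :- a)) := ((a :+ a) :+ (a :+ a)) :* f) refl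
  where open +-*-Solver

¼ : ℚ
¼ = + 1 / 4

difference-of-squares-shifted-by-¼ : ∀ f → (f + ¼) *ℚ (f + ¼) - (f - ¼) *ℚ (f - ¼) ≡ f
difference-of-squares-shifted-by-¼ f = trans (difference-of-shifted-squares f ¼) (*-identityˡ f)

4+n≤4*[1+n] : ∀ n → suc (suc (suc (suc n))) ≤ 4 * suc n
4+n≤4*[1+n] n rewrite *-comm 4 (suc n) = s≤s (s≤s (s≤s (s≤s (m≤m*n n 4))))

proposition4p8 : ∃[ c ] (∀ {n m} (G : Circuit n (suc m)) →
    ∃[ p ] ∃[ q ] Σ (Circuit n (suc p)) λ GP → Σ (Circuit n (suc q)) λ GN →
    suc p ≤ c * suc m × suc q ≤ c * suc m × Conic GP × Conic GN ×
    (∀ (x : Fin n → ℚ) → eval GP x - eval GN x ≡ eval G x))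
proposition4p8 = 4 , λ {_} {m} G →
  let module P = ShiftedSquare G ¼
      module N = ShiftedSquare G (- ¼)
  in _ , _ , P.circuit , N.circuit , 4+n≤4*[1+n] m , 4+n≤4*[1+n] m , P.conic , N.conic ,
     λ x → trans (cong₂ _-_ (P.eval-circuit x) (N.eval-circuit x))
                 (difference-of-squares-shifted-by-¼ (eval G x))
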